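{- Let $G_\sigma$ be a sign-connected signed graph that contains two vertex-disjoint negative cycles. Then every sign articulation vertex of $G_\sigma$ is an articulation vertex.
   Context: A signed graph consists of a finite undirected graph, in which loops and multiple edges are allowed, with a sign $\pm1$ on each edge. Cycles are elementary; a loop is a cycle of length 1. Chains are walks. Signs of cycles and chains are products of their edge signs, counted with multiplicity. Vertices $u,v$ are sign connected if $u=v$ or both a positive and a negative chain join them. The signed graph is sign connected if every two vertices are sign connected. For a sign-connected $G_\sigma$, a vertex $x$ is a sign articulation vertex if $G_\sigma-x$ is not sign connected. An articulation vertex is a vertex $v$ for which there exist edges $e,f$ such that every chain from $e$ to $f$ passes through $v$. A vertex supporting a loop is an articulation vertex unless it is incident with no other edge. -}

module Defs where

open import Data.Nat using (ℕ; suc; _≤_)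
open import Data.Fin using (Fin)
open import Data.Product using (_×_; _,_; Σ; ∃; ∃-syntax)
open import Data.Sum using (_⊎_)
open import Data.List using (List; []; _∷_; length; _++_)
open import Data.List.Relation.Unary.All using (All)
open import Data.List.Relation.Unary.Unique.Propositional using (Unique)
open import Data.List.Membership.Propositional using (_∈_; _∉_)
open import Data.Maybe using (Maybe; just; nothing)
open import Data.Sign using (Sign) renaming (_*_ to _⊛_)
open import Relation.Binary.PropositionalEquality using (_≡_; _≢_)
open import Relation.Nullary using (¬_)

-- A finite signed graph with vertices Fin n and edges Fin m.
-- Loops (ends e = (v , v)) and multiple edges are allowed.
record SignedGraph : Set where
  field
    n    : ℕ
    m    : ℕ
    ends : Fin m → Fin n × Fin n
    sign : Fin m → Sign

module _ (G : SignedGraph) where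
  open SignedGraph G

  Joins : Fin m → Fin n → Fin n → Set
  Joins e u w = ends e ≡ (u , w) ⊎ ends e ≡ (w , u)

  data Walk : Fin n → Fin n → Set where
    []   : ∀ {u} → Walk u u
    step : ∀ {u w v} (e : Fin m) → Joins e u w → Walk w v → Walk u v

  walkSign : ∀ {u v} → Walk u v → Sign
  walkSign []           = Sign.+
  walkSign (step e _ W) = sign e ⊛ walkSign W

  verts : ∀ {u v} → Walk u v → List (Fin n)
  verts {u} []          = u ∷ []
  verts {u} (step _ _ W) = u ∷ verts W

  edges : ∀ {u v} → Walk u v → List (Fin m)
  edges []           = []
  edges (step e _ W) = e ∷ edges W

  firstEdge : ∀ {u v} → Walk u v → Maybe (Fin m)
  firstEdge []           = nothing
  firstEdge (step e _ _) = just e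

  lastEdge : ∀ {u v} → Walk u v → Maybe (Fin m)
  lastEdge []                     = nothing
  lastEdge (step e _ [])          = just e
  lastEdge (step _ _ W@(step _ _ _)) = lastEdge W

  interior : ∀ {u v} → Walk u v → List (Fin n)
  interior []                        = []
  interior (step _ _ [])             = []
  interior (step {w = w} _ _ W@(step _ _ _)) = w ∷ interior W

  -- u and v are sign connected using only chains all of whose vertices satisfy P
  -- (with P = "≢ x" these are exactly the chains of G - x)
  SignConnectedVia : (Fin n → Set) → Fin n → Fin n → Set
  SignConnectedVia P u v =
    u ≡ v ⊎
    ((Σ (Walk u v) λ W → All P (verts W) × walkSign W ≡ Sign.+) ×
     (Σ (Walk u v) λ W → All P (verts W) × walkSign W ≡ Sign.-))

  SignConnectedVertices : Fin n → Fin n → Set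
  SignConnectedVertices u v =
    u ≡ v ⊎
    ((Σ (Walk u v) λ W → walkSign W ≡ Sign.+) ×
     (Σ (Walk u v) λ W → walkSign W ≡ Sign.-))

  SignConnected : Set
  SignConnected = ∀ u v → SignConnectedVertices u v

  SignConnectedDel : Fin n → Set
  SignConnectedDel x = ∀ u v → u ≢ x → v ≢ x → SignConnectedVia (λ y → y ≢ x) u v

  SignArticulationVertex : Fin n → Set
  SignArticulationVertex x = SignConnected × ¬ SignConnectedDel x

  -- there exist edges e, f such that every chain from e to f passes through x
  -- (i.e. x is an interior vertex of every chain whose first edge is e and last edge is f)
  ArticulationVertex : Fin n → Set
  ArticulationVertex x =
    Σ (Fin m) λ e → Σ (Fin m) λ f →
      ∀ {u v} (W : Walk u v) → firstEdge W ≡ just e → lastEdge W ≡ just f → x ∈ interior W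

  -- an (elementary) cycle: a closed chain of length ≥ 1 with distinct edges,
  -- whose vertices v₀ … v_{k-1} are distinct (a loop is a cycle of length 1)
  record Cycle : Set where
    field
      base     : Fin n
      walk     : Walk base base
      nonempty : 1 ≤ length (edges walk)
      edgesDistinct : Unique (edges walk)
      vertsDistinct : Unique (interior walk ++ (base ∷ []))

  cycleVerts : Cycle → List (Fin n)
  cycleVerts C = interior (Cycle.walk C) ++ (Cycle.base C ∷ [])

  NegativeCycle : Cycle → Set
  NegativeCycle C = walkSign (Cycle.walk C) ≡ Sign.-

  VertexDisjoint : Cycle → Cycle → Set
  VertexDisjoint C D = ∀ y → y ∈ cycleVerts C → y ∉ cycleVerts D

module Submission where

-- Of two vertex-disjoint negative cycles at least one avoids
-- the sign articulation vertex x; let N be that cycle, read as a negative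
-- closed chain at a vertex c of G - x.  Call v "reaching" if a chain of
-- G - x joins v to c.
--   * If every vertex v ≠ x is reaching, G - x is sign connected: for chains
--     A : u ⇝ c and B : v ⇝ c in G - x, the chains A·B⁻¹ and A·N·B⁻¹ have
--     opposite signs.  This contradicts x being a sign articulation vertex.
--   * Otherwise some u ≠ x is not reaching.  Since G is sign connected, a
--     chain of G starts at u with some edge e.  Both ends of the first edge f
--     of N are reaching, so a chain from e to f avoiding x in its interior
--     would make u reaching; hence x is an articulation vertex (for e, f).
-- The case split needs reachability in G - x to be decidable.  This is a
-- general fact about decidable relations on a finite set, proved first by
-- computing the closure of {c} under backward steps; it grows strictly until
-- it is closed, so n + 1 rounds suffice.

open import Defs
open import Level using (0ℓ)
open import Data.Nat using (ℕ; zero; suc; _≤_; z≤n; s≤s)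
open import Data.Nat.Properties using (≤-trans; ≤⇒≯)
open import Data.Fin using (Fin) renaming (_≟_ to _≟ᶠ_)
open import Data.Fin.Properties using (any?; all?; ¬∀⟶∃¬)
open import Data.Fin.Subset using (Subset; _∈_; _⊆_; _⊂_; ⁅_⁆; ∣_∣)
open import Data.Fin.Subset.Properties
  using (_∈?_; x∈⁅x⁆; x∈⁅y⁆⇒x≡y; p⊂q⇒∣p∣<∣q∣; ∣p∣≤n)
open import Data.Vec using (tabulate)
open import Data.Vec.Properties using ([]=⇒lookup; lookup⇒[]=; lookup∘tabulate)
open import Data.Product using (Σ; _×_; _,_; proj₁; proj₂; ∃-syntax)
open import Data.Product.Properties using (≡-dec)
open import Data.Sum using (_⊎_; inj₁; inj₂)
open import Data.Bool using (true)
open import Data.Empty using (⊥-elim)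
open import Data.List using (List; []; _∷_; _++_; length)
open import Data.List.Relation.Unary.All as All using (All; _∷_)
open import Data.List.Relation.Unary.All.Properties using (++⁺; ++⁻ʳ; ¬Any⇒All¬)
import Data.List.Membership.Propositional as List
import Data.List.Membership.DecPropositional as DecMembership
open import Data.Maybe using (just)
open import Data.Maybe.Properties using (just-injective)
open import Data.Sign using (Sign; opposite) renaming (_*_ to _⊛_)
open import Data.Sign.Properties using () renaming (*-assoc to ⊛-assoc)
open import Relation.Binary using (Rel; Decidable)
open import Relation.Binary.Construct.Closure.ReflexiveTransitive using (Star; ε; _◅_)
open import Relation.Binary.PropositionalEquality
open import Relation.Nullary using (¬_; Dec; yes; no; does)
open import Relation.Nullary.Decidable using (dec-true; map′; ¬?; _×-dec_; _⊎-dec_)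
open import Relation.Unary using (Pred)
open import Function using (_∘_)

_∈ˡ?_ : ∀ {n} (v : Fin n) (vs : List (Fin n)) → Dec (v List.∈ vs)
_∈ˡ?_ = DecMembership._∈?_ _≟ᶠ_

∉⇒All≢ : ∀ {n} {x : Fin n} {vs : List (Fin n)} → x List.∉ vs → All (_≢ x) vs
∉⇒All≢ x∉ = All.map (_∘ sym) (¬Any⇒All¬ _ x∉)

module _ {n : ℕ} {P : Pred (Fin n) 0ℓ} where

  subsetOf : (∀ v → Dec (P v)) → Subset n
  subsetOf P? = tabulate (λ v → does (P? v))

  private
    yesWitness : {A : Set} (d : Dec A) → does d ≡ true → A
    yesWitness (yes a) _ = a
    yesWitness (no _) ()

  ∈subsetOf⁻ : (P? : ∀ v → Dec (P v)) {v : Fin n} → v ∈ subsetOf P? → P v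
  ∈subsetOf⁻ P? {v} v∈ =
    yesWitness (P? v) (trans (sym (lookup∘tabulate _ v)) ([]=⇒lookup v∈))

  ∈subsetOf⁺ : (P? : ∀ v → Dec (P v)) {v : Fin n} → P v → v ∈ subsetOf P?
  ∈subsetOf⁺ P? {v} pv =
    lookup⇒[]= v _ (trans (lookup∘tabulate _ v) (dec-true (P? v) pv))

module FiniteReachability {n : ℕ} {Step : Rel (Fin n) 0ℓ}
                          (step? : Decidable Step) (t : Fin n) where

  Extends : Subset n → Fin n → Set
  Extends S v = v ∈ S ⊎ ∃[ u ] (u ∈ S × Step v u)

  extends? : ∀ S v → Dec (Extends S v)
  extends? S v = (v ∈? S) ⊎-dec any? (λ u → (u ∈? S) ×-dec step? v u)

  grow : Subset n → Subset n
  grow S = subsetOf (extends? S)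

  grow-sound : ∀ {S v} → v ∈ grow S → Extends S v
  grow-sound {S} = ∈subsetOf⁻ (extends? S)

  grow-complete : ∀ {S v} → Extends S v → v ∈ grow S
  grow-complete {S} = ∈subsetOf⁺ (extends? S)

  ⊆-grow : ∀ {S} → S ⊆ grow S
  ⊆-grow v∈ = grow-complete (inj₁ v∈)

  Closed : Subset n → Set
  Closed S = ∀ {u v} → u ∈ S → Step v u → v ∈ S

  grows-or-stable : ∀ S → S ⊂ grow S ⊎ grow S ⊆ S
  grows-or-stable S with any? (λ v → (v ∈? grow S) ×-dec ¬? (v ∈? S))
  ... | yes (v , v∈ , v∉) = inj₁ (⊆-grow , v , v∈ , v∉)
  ... | no noNew = inj₂ λ {v} v∈ → stays v∈ (v ∈? S)
    where
      stays : ∀ {v} → v ∈ grow S → Dec (v ∈ S) → v ∈ S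
      stays _  (yes v∈S) = v∈S
      stays v∈ (no v∉S)  = ⊥-elim (noNew (_ , v∈ , v∉S))

  stable⇒closed : ∀ {S} → grow S ⊆ S → Closed S
  stable⇒closed stable u∈ st = stable (grow-complete (inj₂ (_ , u∈ , st)))

  closed⇒¬grows : ∀ {S} → Closed S → ¬ (S ⊂ grow S)
  closed⇒¬grows closed (_ , v , v∈ , v∉) with grow-sound v∈
  ... | inj₁ v∈S            = v∉ v∈S
  ... | inj₂ (_ , u∈ , st) = v∉ (closed u∈ st)

  stage : ℕ → Subset n
  stage zero    = ⁅ t ⁆
  stage (suc k) = grow (stage k)

  closed-or-large : ∀ k → Closed (stage k) ⊎ k ≤ ∣ stage k ∣
  closed-or-large zero = inj₂ z≤n
  closed-or-large (suc k) with grows-or-stable (stage k) | closed-or-large k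
  ... | inj₂ stable | _ =
        inj₁ λ u∈ st → ⊆-grow (stable⇒closed stable (stable u∈) st)
  ... | inj₁ grows | inj₁ closed = ⊥-elim (closed⇒¬grows closed grows)
  ... | inj₁ grows | inj₂ large  = inj₂ (≤-trans (s≤s large) (p⊂q⇒∣p∣<∣q∣ grows))

  closure : Subset n
  closure = stage (suc n)

  closure-closed : Closed closure
  closure-closed with closed-or-large (suc n)
  ... | inj₁ closed = closed
  ... | inj₂ large  = ⊥-elim (≤⇒≯ (∣p∣≤n closure) large)

  stage-sound : ∀ k {v} → v ∈ stage k → Star Step v t
  stage-sound zero v∈ with refl ← x∈⁅y⁆⇒x≡y t v∈ = ε
  stage-sound (suc k) v∈ with grow-sound v∈
  ... | inj₁ v∈′            = stage-sound k v∈′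
  ... | inj₂ (_ , u∈ , st) = st ◅ stage-sound k u∈

  t∈stage : ∀ k → t ∈ stage k
  t∈stage zero    = x∈⁅x⁆ t
  t∈stage (suc k) = ⊆-grow (t∈stage k)

  closure-complete : ∀ {v} → Star Step v t → v ∈ closure
  closure-complete ε         = t∈stage (suc n)
  closure-complete (st ◅ s) = closure-closed (closure-complete s) st

  reaches? : ∀ v → Dec (Star Step v t)
  reaches? v = map′ (stage-sound (suc n)) closure-complete (v ∈? closure)

module Chains (G : SignedGraph) where
  open SignedGraph G

  joins? : ∀ e a b → Dec (Joins G e a b)
  joins? e a b = ≡-dec _≟ᶠ_ _≟ᶠ_ (ends e) (a , b) ⊎-dec ≡-dec _≟ᶠ_ _≟ᶠ_ (ends e) (b , a)

  joins-sym : ∀ {e a b} → Joins G e a b → Joins G e b a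
  joins-sym (inj₁ p) = inj₂ p
  joins-sym (inj₂ p) = inj₁ p

  endpoint : ∀ {e a b u w} → Joins G e a b → Joins G e u w → u ≡ a ⊎ u ≡ b
  endpoint (inj₁ p) (inj₁ q) = inj₁ (cong proj₁ (trans (sym q) p))
  endpoint (inj₁ p) (inj₂ q) = inj₂ (cong proj₂ (trans (sym q) p))
  endpoint (inj₂ p) (inj₁ q) = inj₂ (cong proj₁ (trans (sym q) p))
  endpoint (inj₂ p) (inj₂ q) = inj₁ (cong proj₂ (trans (sym q) p))

  infixr 5 _++ʷ_
  _++ʷ_ : ∀ {u v w} → Walk G u v → Walk G v w → Walk G u w
  []           ++ʷ B = B
  step e j A   ++ʷ B = step e j (A ++ʷ B)

  reverse : ∀ {u v} → Walk G u v → Walk G v u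
  reverse []           = []
  reverse (step e j W) = reverse W ++ʷ step e (joins-sym j) []

  sign-++ : ∀ {u v w} (A : Walk G u v) (B : Walk G v w) →
            walkSign G (A ++ʷ B) ≡ walkSign G A ⊛ walkSign G B
  sign-++ []           B = refl
  sign-++ (step e j A) B =
    trans (cong (sign e ⊛_) (sign-++ A B)) (sym (⊛-assoc (sign e) _ _))

  verts-tail : ∀ {u w v} e (j : Joins G e u w) (W : Walk G w v) →
               verts G W ≡ interior G (step e j W) ++ (v ∷ [])
  verts-tail e j []              = refl
  verts-tail {w = w} e j (step e′ j′ W) = cong (w ∷_) (verts-tail e′ j′ W)

  lastEdge-joins : ∀ {f a b} (W : Walk G a b) → lastEdge G W ≡ just f →
                   ∃[ a′ ] Joins G f a′ b
  lastEdge-joins (step e j []) eq with refl ← just-injective eq = _ , j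
  lastEdge-joins (step _ _ W@(step _ _ _)) eq = lastEdge-joins W eq

  module _ {P : Fin n → Set} where

    head : ∀ {u v} (W : Walk G u v) → All P (verts G W) → P u
    head []           (p ∷ _) = p
    head (step _ _ _) (p ∷ _) = p

    All-++ : ∀ {u v w} (A : Walk G u v) (B : Walk G v w) →
             All P (verts G A) → All P (verts G B) → All P (verts G (A ++ʷ B))
    All-++ []           B _          pB = pB
    All-++ (step e j A) B (p ∷ pA) pB = p ∷ All-++ A B pA pB

    All-reverse : ∀ {u v} (W : Walk G u v) → All P (verts G W) → All P (verts G (reverse W))
    All-reverse []           pW         = pW
    All-reverse (step e j W) (p ∷ pW) =
      All-++ (reverse W) _ (All-reverse W pW) (head W pW ∷ p ∷ All.[])

⊛-opposite : ∀ s t → s ⊛ opposite t ≡ opposite (s ⊛ t)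
⊛-opposite Sign.+ t = refl
⊛-opposite Sign.- t = refl

module Deletion (G : SignedGraph) (x : Fin (SignedGraph.n G)) where
  open SignedGraph G
  open Chains G

  Avoids : ∀ {u v} → Walk G u v → Set
  Avoids W = All (_≢ x) (verts G W)

  Reaches : Fin n → Fin n → Set
  Reaches c v = Σ (Walk G v c) Avoids

  StepAvoiding : Rel (Fin n) 0ℓ
  StepAvoiding v w = v ≢ x × ∃[ e ] Joins G e v w

  reaches⇒star : ∀ {c v} → Reaches c v → Star StepAvoiding v c
  reaches⇒star ([] , _)              = ε
  reaches⇒star (step e j W , p ∷ pW) = (p , e , j) ◅ reaches⇒star (W , pW)

  star⇒reaches : ∀ {c v} → c ≢ x → Star StepAvoiding v c → Reaches c v
  star⇒reaches c≢x ε = [] , c≢x ∷ All.[]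
  star⇒reaches c≢x ((p , e , j) ◅ s) with star⇒reaches c≢x s
  ... | W , pW = step e j W , p ∷ pW

  reaches? : ∀ {c} → c ≢ x → ∀ v → Dec (Reaches c v)
  reaches? {c} c≢x v = map′ (star⇒reaches c≢x) reaches⇒star (Reachability.reaches? v)
    where
      module Reachability = FiniteReachability
        (λ v w → ¬? (v ≟ᶠ x) ×-dec any? (λ e → joins? e v w)) c

  opposite⇒signConnected : ∀ {u v} (W W′ : Walk G u v) → Avoids W → Avoids W′ →
    walkSign G W′ ≡ opposite (walkSign G W) → SignConnectedVia G (_≢ x) u v
  opposite⇒signConnected W W′ aW aW′ eq with walkSign G W in sW
  ... | Sign.+ = inj₂ ((W , aW , sW) , (W′ , aW′ , eq))
  ... | Sign.- = inj₂ ((W′ , aW′ , eq) , (W , aW , sW))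

  allReach⇒signConnectedDel : ∀ {c} (N : Walk G c c) → Avoids N →
    walkSign G N ≡ Sign.- → (∀ v → v ≢ x → Reaches c v) → SignConnectedDel G x
  allReach⇒signConnectedDel N aN negN reach u v u≢x v≢x
    with reach u u≢x | reach v v≢x
  ... | A , aA | B , aB =
    opposite⇒signConnected (A ++ʷ reverse B) (A ++ʷ N ++ʷ reverse B)
      (All-++ A _ aA aB⁻¹) (All-++ A _ aA (All-++ N _ aN aB⁻¹)) signs
    where
      open ≡-Reasoning
      aB⁻¹ : Avoids (reverse B)
      aB⁻¹ = All-reverse B aB
      signs : walkSign G (A ++ʷ N ++ʷ reverse B) ≡ opposite (walkSign G (A ++ʷ reverse B))
      signs = begin
        walkSign G (A ++ʷ N ++ʷ reverse B)
          ≡⟨ trans (sign-++ A _) (cong (walkSign G A ⊛_) (sign-++ N _)) ⟩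
        walkSign G A ⊛ (walkSign G N ⊛ walkSign G (reverse B))
          ≡⟨ cong (λ s → walkSign G A ⊛ (s ⊛ walkSign G (reverse B))) negN ⟩
        walkSign G A ⊛ opposite (walkSign G (reverse B))
          ≡⟨ ⊛-opposite (walkSign G A) _ ⟩
        opposite (walkSign G A ⊛ walkSign G (reverse B))
          ≡⟨ cong opposite (sym (sign-++ A _)) ⟩
        opposite (walkSign G (A ++ʷ reverse B)) ∎

  reachAlong : ∀ {c u w e a b} → u ≢ x → Joins G e u w → (W : Walk G a b) →
    firstEdge G W ≡ just e → ¬ x List.∈ interior G W → Reaches c b → Reaches c u
  reachAlong u≢x je (step e j W₁) refl x∉ (B , aB)
    with endpoint j je | W₁ ++ʷ B , All-++ W₁ B aW₁ aB
    where
      aW₁ : Avoids W₁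
      aW₁ = subst (All (_≢ x)) (sym (verts-tail e j W₁))
              (++⁺ (∉⇒All≢ x∉) (head B aB ∷ All.[]))
  ... | inj₁ refl | R , aR = step e j R , u≢x ∷ aR
  ... | inj₂ refl | R      = R

  separates : ∀ {c u w e f} → u ≢ x → ¬ Reaches c u → Joins G e u w →
    (∀ {a b} → Joins G f a b → Reaches c b) →
    ∀ {a b} (W : Walk G a b) → firstEdge G W ≡ just e → lastEdge G W ≡ just f →
    x List.∈ interior G W
  separates u≢x unreached je endsReach W first last with x ∈ˡ? interior G W
  ... | yes x∈ = x∈
  ... | no x∉ = ⊥-elim (unreached
        (reachAlong u≢x je W first x∉ (endsReach (proj₂ (lastEdge-joins W last)))))

  reach-dichotomy : ∀ {c} → c ≢ x →
    (∀ v → v ≢ x → Reaches c v) ⊎ ∃[ u ] (u ≢ x × ¬ Reaches c u)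
  reach-dichotomy c≢x with all? (λ v → (v ≟ᶠ x) ⊎-dec reaches? c≢x v)
  ... | yes everyone = inj₁ λ v v≢x → reachingUnless v≢x (everyone v)
    where
      reachingUnless : ∀ {c v} → v ≢ x → v ≡ x ⊎ Reaches c v → Reaches c v
      reachingUnless v≢x (inj₁ v≡x) = ⊥-elim (v≢x v≡x)
      reachingUnless v≢x (inj₂ r)   = r
  ... | no notEveryone
    with u , u∉ ← ¬∀⟶∃¬ n _ (λ v → (v ≟ᶠ x) ⊎-dec reaches? c≢x v) notEveryone
    = inj₂ (u , u∉ ∘ inj₁ , u∉ ∘ inj₂)

  -- in a sign connected graph, an unreached vertex u ≠ x and an edge f whose
  -- ends reach c make x an articulation vertex (separating f from the first
  -- edge of a chain from u to c)
  unreached⇒articulation : ∀ {c u} f → SignConnected G → u ≢ x → ¬ Reaches c u →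
    (∀ {a b} → Joins G f a b → Reaches c b) → ArticulationVertex G x
  unreached⇒articulation {c} {u} f SC u≢x unreached endsReach with SC u c
  ... | inj₁ refl                       = ⊥-elim (unreached ([] , u≢x ∷ All.[]))
  ... | inj₂ (([] , _) , _)             = ⊥-elim (unreached ([] , u≢x ∷ All.[]))
  ... | inj₂ ((step e je _ , _) , _) = e , f , separates u≢x unreached je endsReach

  firstEdge-endsReach : ∀ {c w} f (jf : Joins G f c w) (rest : Walk G w c) →
    Avoids (step f jf rest) → ∀ {a b} → Joins G f a b → Reaches c b
  firstEdge-endsReach f jf rest (c≢x ∷ aRest) jb with endpoint jf (joins-sym jb)
  ... | inj₁ refl = [] , c≢x ∷ All.[]
  ... | inj₂ refl = rest , aRest

  negativeClosedChain⇒articulation : SignConnected G → ¬ SignConnectedDel G x →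
    ∀ {c w} f (jf : Joins G f c w) (rest : Walk G w c) →
    Avoids (step f jf rest) → walkSign G (step f jf rest) ≡ Sign.- →
    ArticulationVertex G x
  negativeClosedChain⇒articulation SC ¬SCD f jf rest aN negN
    with reach-dichotomy (head (step f jf rest) aN)
  ... | inj₁ everyone = ⊥-elim (¬SCD (allReach⇒signConnectedDel (step f jf rest) aN negN everyone))
  ... | inj₂ (u , u≢x , unreached) =
        unreached⇒articulation f SC u≢x unreached (firstEdge-endsReach f jf rest aN)

  -- a negative cycle not through x is a negative closed chain of G - x
  cycleAvoiding⇒articulation : SignConnected G → ¬ SignConnectedDel G x →
    (C : Cycle G) → NegativeCycle G C → x List.∉ cycleVerts G C → ArticulationVertex G x
  cycleAvoiding⇒articulation SC ¬SCD C = onWalk (Cycle.walk C) (Cycle.nonempty C)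
    where
      onWalk : ∀ {c} (N : Walk G c c) → 1 ≤ length (edges G N) → walkSign G N ≡ Sign.- →
               x List.∉ interior G N ++ (c ∷ []) → ArticulationVertex G x
      onWalk []               ()
      onWalk (step f jf rest) _  negN x∉ =
        negativeClosedChain⇒articulation SC ¬SCD f jf rest aN negN
        where
          aInteriorBase : All (_≢ x) (interior G (step f jf rest) ++ (_ ∷ []))
          aInteriorBase = ∉⇒All≢ x∉
          aN : Avoids (step f jf rest)
          aN = All.head (++⁻ʳ (interior G (step f jf rest)) aInteriorBase)
             ∷ subst (All (_≢ x)) (sym (verts-tail f jf rest)) aInteriorBase

-- Of two vertex-disjoint negative cycles, one avoids x.
proposition3p10 : (G : SignedGraph) → SignConnected G →
    (Σ (Cycle G) λ C → Σ (Cycle G) λ D →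
       NegativeCycle G C × NegativeCycle G D × VertexDisjoint G C D) →
    (x : Fin (SignedGraph.n G)) → SignArticulationVertex G x → ArticulationVertex G x
proposition3p10 G SC (C , D , negC , negD , disjoint) x (_ , ¬SCD) =
  avoidedCycle (x ∈ˡ? cycleVerts G C)
  where
    open Deletion G x
    avoidedCycle : Dec (x List.∈ cycleVerts G C) → ArticulationVertex G x
    avoidedCycle (no x∉C)  = cycleAvoiding⇒articulation SC ¬SCD C negC x∉C
    avoidedCycle (yes x∈C) = cycleAvoiding⇒articulation SC ¬SCD D negD (disjoint x x∈C)
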